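{- Let $n\ge1$ and let $F=[\,^{a_1}\ell_1,\,^{a_2}\ell_2,\ldots,\,^{a_s}\ell_s]$ be a $2$-regular graph of odd order $2n+1$ satisfying: (1) $V(F)=\mathbb{Z}_{2n}\cup\{\infty\}$; (2) $\Delta F\supseteq \mathbb{Z}_{2n}\setminus\{0\}$; (3) $F+n=F$. Then $|\{i : a_i\ell_i \text{ is odd}\}| = 1$.
   Context: The notation $[\,^{a_1}\ell_1,\ldots,\,^{a_s}\ell_s]$ denotes a $2$-regular graph that is a disjoint union of cycles, containing exactly $a_i$ cycles of length $\ell_i$ for each $i$, where $\ell_1,\dots,\ell_s$ are distinct. For a graph $\Gamma$ with vertices in $\mathbb{Z}_{2n}\cup\{\infty\}$, $\Delta\Gamma$ is the multiset of all differences $x-y\in\mathbb{Z}_{2n}$ over all ordered pairs $(x,y)$ of adjacent vertices of $\Gamma$ with $x,y\neq\infty$ (each such edge contributes both $x-y$ and $y-x$). For $g\in\mathbb{Z}_{2n}$, $\Gamma+g$ is the graph obtained from $\Gamma$ by replacing each vertex $x\neq\infty$ with $x+g$ (and fixing $\infty$). -}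

module Defs where

open import Data.Nat using (ℕ; zero; suc; _+_; _*_; _∸_; _<_; _≤_)
open import Data.Nat.DivMod using (_mod_; _%_)
open import Data.Fin using (Fin; toℕ)
import Data.Fin as Fin
open import Data.Maybe using (Maybe; just; nothing)
open import Data.Maybe.Properties using (≡-dec)
open import Data.Bool using (Bool; true; false; _∧_; _∨_)
open import Data.List using (List; _∷_; []; map; length; filterᵇ; allFin; upTo)
open import Data.Bool.ListAction using (any)
open import Relation.Nullary.Decidable using (⌊_⌋)
open import Relation.Binary.PropositionalEquality using (_≡_)

-- Vertex set  ℤ_{2n} ∪ {∞}:  `just x` is x ∈ ℤ_{2n} (= Fin (2n)), `nothing` is ∞.
V : ℕ → Set
V n = Maybe (Fin (2 * n))

∞ : {n : ℕ} → V n
∞ = nothing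

vertices : (n : ℕ) → List (V n)
vertices n = nothing ∷ map just (allFin (2 * n))

_≟V_ : {n : ℕ} → (u v : V n) → Bool
u ≟V v = ⌊ ≡-dec Fin._≟_ u v ⌋

countᵇ : {A : Set} → (A → Bool) → List A → ℕ
countᵇ p xs = length (filterᵇ p xs)

record TwoRegular (n : ℕ) (adj : V n → V n → Bool) : Set where
  field
    symmetric   : ∀ u v → adj u v ≡ adj v u
    irreflexive : ∀ v → adj v v ≡ false
    degree-two  : ∀ v → countᵇ (adj v) (vertices n) ≡ 2

-- Arithmetic in ℤ_{2n}
-- x - y  (mod 2n), returned as a natural number in [0, 2n)
diff : (n : ℕ) → Fin (2 * n) → Fin (2 * n) → ℕ
diff zero  () y
diff (suc k) x y = (toℕ x + (2 * suc k ∸ toℕ y)) % (2 * suc k)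

shiftFin : {n : ℕ} → Fin (2 * n) → Fin (2 * n)
shiftFin {zero}  ()
shiftFin {suc k} x = (toℕ x + suc k) mod (2 * suc k)

shiftV : (n : ℕ) → V n → V n
shiftV n (just x) = just (shiftFin {n} x)
shiftV n nothing  = nothing

reach : (n : ℕ) → (V n → V n → Bool) → ℕ → V n → V n → Bool
reach n adj zero    v w = _≟V_ {n} v w
reach n adj (suc k) v w =
  reach n adj k v w ∨ any (λ u → reach n adj k v u ∧ adj u w) (vertices n)

-- number of vertices in the connected component of v
-- (for a 2-regular graph: the length of the cycle through v)
compSize : {n : ℕ} → (V n → V n → Bool) → V n → ℕ
compSize {n} adj v = countᵇ (reach n adj (2 * n + 1) v) (vertices n)

-- a_ℓ · ℓ  = number of vertices lying on cycles of length ℓ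
vertsOnCyclesOfLength : {n : ℕ} → (V n → V n → Bool) → ℕ → ℕ
vertsOnCyclesOfLength {n} adj ℓ = countᵇ (λ v → compSize {n} adj v Data.Nat.≡ᵇ ℓ) (vertices n)

isOdd : ℕ → Bool
isOdd m = m % 2 Data.Nat.≡ᵇ 1

-- |{ i : a_i ℓ_i odd }| ; cycle lengths ℓ range over 0 .. 2n+1
-- (lengths not occurring contribute a_ℓ ℓ = 0, which is even)
numOddClasses : (n : ℕ) → (V n → V n → Bool) → ℕ
numOddClasses n adj =
  countᵇ (λ ℓ → isOdd (vertsOnCyclesOfLength {n} adj ℓ)) (upTo (2 * n + 2))

-- The shift x ↦ x + n is an involution of ℤ_{2n} ∪ {∞} fixing only ∞, and by (3) it is an
-- automorphism of F, so it maps every cycle onto a cycle of the same length. Hence for each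
-- length ℓ the set of vertices on cycles of length ℓ is shift-invariant, and its finite part
-- splits into the pairs {x, x + n}. So a_ℓ ℓ is odd exactly when ∞ lies on a cycle of length ℓ,
-- which happens for exactly one ℓ.
module Submission where

open import Defs
open import Data.Nat using (ℕ; _≤_; _<_)
open import Data.Bool using (Bool; true)
open import Data.Fin using (Fin)
open import Data.Maybe using (just)
open import Data.Product using (Σ; _×_)
open import Relation.Binary.PropositionalEquality using (_≡_)

open import Data.Nat using (zero; suc; _+_; _*_; _≡ᵇ_; _<ᵇ_; s≤s)
open import Data.Nat.Properties using (+-comm; +-assoc; +-identityʳ; *-comm; ≤-trans; ≤-reflexive)
open import Data.Nat.DivMod using (_%_; _mod_; %-distribˡ-+; m%n%n≡m%n; [m+n]%n≡m%n; [m+kn]%n≡m%n; m<n⇒m%n≡m; m%n<n)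
open import Data.Fin using (toℕ)
import Data.Fin as Fin
open import Data.Fin.Properties using (toℕ-injective; toℕ-fromℕ<; toℕ<n)
open import Data.Bool using (false; T?; _∧_; _∨_)
open import Data.Maybe using (nothing)
open import Data.Maybe.Properties using (≡-dec)
open import Data.List using (List; []; _∷_; _++_; map; length; filterᵇ; tabulate; applyUpTo; upTo; allFin)
open import Data.List.Properties
  using (filter-++; length-++; length-filter; length-map; length-tabulate;
         map-cong; map-upTo; map-applyUpTo; map-tabulate; tabulate-cong)
open import Data.Bool.ListAction using (any)
open import Function using (_∘_; id)
open import Relation.Binary.PropositionalEquality using (refl; sym; trans; cong; cong₂; subst; module ≡-Reasoning)
open import Relation.Nullary using (yes; no; contradiction)

private
  variable
    A B : Set

countᵇ-cong : {p q : A → Bool} → (∀ x → p x ≡ q x) → ∀ xs → countᵇ p xs ≡ countᵇ q xs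
countᵇ-cong         p≗q []       = refl
countᵇ-cong {q = q} p≗q (x ∷ xs) rewrite p≗q x with q x
... | true  = cong suc (countᵇ-cong p≗q xs)
... | false = countᵇ-cong p≗q xs

countᵇ-++ : (p : A → Bool) (xs ys : List A) → countᵇ p (xs ++ ys) ≡ countᵇ p xs + countᵇ p ys
countᵇ-++ p xs ys = trans (cong length (filter-++ (T? ∘ p) xs ys)) (length-++ (filterᵇ p xs))

countᵇ-map : (p : B → Bool) (f : A → B) (xs : List A) → countᵇ p (map f xs) ≡ countᵇ (p ∘ f) xs
countᵇ-map p f []       = refl
countᵇ-map p f (x ∷ xs) with p (f x)
... | true  = cong suc (countᵇ-map p f xs)
... | false = countᵇ-map p f xs

countᵇ-false : (xs : List A) → countᵇ (λ _ → false) xs ≡ 0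
countᵇ-false []       = refl
countᵇ-false (_ ∷ xs) = countᵇ-false xs

countᵇ-≤-length : (p : A → Bool) (xs : List A) → countᵇ p xs ≤ length xs
countᵇ-≤-length p = length-filter (T? ∘ p)

any≡0<ᵇcountᵇ : (p : A → Bool) (xs : List A) → any p xs ≡ (0 <ᵇ countᵇ p xs)
any≡0<ᵇcountᵇ p []       = refl
any≡0<ᵇcountᵇ p (x ∷ xs) with p x
... | true  = refl
... | false = any≡0<ᵇcountᵇ p xs

countᵇ-≡ᵇ-upTo : ∀ {c m} → c < m → countᵇ (c ≡ᵇ_) (upTo m) ≡ 1
countᵇ-≡ᵇ-upTo {c} {suc m} (s≤s c≤m) = tail c c≤m
  where
  shifted : ∀ c → countᵇ (c ≡ᵇ_) (applyUpTo suc m) ≡ countᵇ ((c ≡ᵇ_) ∘ suc) (upTo m)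
  shifted c = trans (cong (countᵇ (c ≡ᵇ_)) (sym (map-upTo suc m))) (countᵇ-map (c ≡ᵇ_) suc (upTo m))

  tail : ∀ c → c ≤ m → countᵇ (c ≡ᵇ_) (0 ∷ applyUpTo suc m) ≡ 1
  tail zero    _   = cong suc (trans (shifted 0) (countᵇ-false (upTo m)))
  tail (suc c) c<m = trans (shifted (suc c)) (countᵇ-≡ᵇ-upTo c<m)

applyUpTo-+ : (f : ℕ → A) (m n : ℕ) → applyUpTo f (m + n) ≡ applyUpTo f m ++ applyUpTo (f ∘ (m +_)) n
applyUpTo-+ f zero    n = refl
applyUpTo-+ f (suc m) n = cong (f 0 ∷_) (applyUpTo-+ (f ∘ suc) m n)

applyUpTo≡tabulate : (f : ℕ → A) (m : ℕ) → applyUpTo f m ≡ tabulate (f ∘ toℕ {m})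
applyUpTo≡tabulate f zero    = refl
applyUpTo≡tabulate f (suc m) = cong (f 0 ∷_) (applyUpTo≡tabulate (f ∘ suc) m)

isOdd-+-double : ∀ m c → isOdd (m + (c + c)) ≡ isOdd m
isOdd-+-double m c = cong (_≡ᵇ 1) (begin
  (m + (c + c)) % 2 ≡⟨ cong (λ t → (m + (c + t)) % 2) (sym (+-identityʳ c)) ⟩
  (m + 2 * c) % 2   ≡⟨ cong (λ t → (m + t) % 2) (*-comm 2 c) ⟩
  (m + c * 2) % 2   ≡⟨ [m+kn]%n≡m%n m c 2 ⟩
  m % 2             ∎)
  where open ≡-Reasoning

countᵇ-∷-cong : (p q : A → Bool) (x : A) {ys : List A} →
  p x ≡ q x → countᵇ p ys ≡ countᵇ q ys → countᵇ p (x ∷ ys) ≡ countᵇ q (x ∷ ys)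
countᵇ-∷-cong p q x px≡qx eq rewrite px≡qx with q x
... | true  = cong suc eq
... | false = eq

isOdd-countᵇ-∷-double : (p : A → Bool) (x : A) {ys : List A} (c : ℕ) →
  countᵇ p ys ≡ c + c → isOdd (countᵇ p (x ∷ ys)) ≡ p x
isOdd-countᵇ-∷-double p x c eq with p x
... | true  = trans (cong (isOdd ∘ suc) eq) (isOdd-+-double 1 c)
... | false = trans (cong isOdd eq) (isOdd-+-double 0 c)

module _ (σ : A → A) (p : A → Bool) (xs : List A) where

  countᵇ-++-map-invariant : (∀ x → p (σ x) ≡ p x) →
    countᵇ p (xs ++ map σ xs) ≡ countᵇ p xs + countᵇ p xs
  countᵇ-++-map-invariant p∘σ≗p = begin
    countᵇ p (xs ++ map σ xs)           ≡⟨ countᵇ-++ p xs (map σ xs) ⟩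
    countᵇ p xs + countᵇ p (map σ xs)   ≡⟨ cong (countᵇ p xs +_) (countᵇ-map p σ xs) ⟩
    countᵇ p xs + countᵇ (p ∘ σ) xs     ≡⟨ cong (countᵇ p xs +_) (countᵇ-cong p∘σ≗p xs) ⟩
    countᵇ p xs + countᵇ p xs           ∎
    where open ≡-Reasoning

  countᵇ-∘-involution-++-map : (∀ x → σ (σ x) ≡ x) →
    countᵇ (p ∘ σ) (xs ++ map σ xs) ≡ countᵇ p (xs ++ map σ xs)
  countᵇ-∘-involution-++-map σ-involutive = begin
    countᵇ (p ∘ σ) (xs ++ map σ xs)
      ≡⟨ countᵇ-++ (p ∘ σ) xs (map σ xs) ⟩
    countᵇ (p ∘ σ) xs + countᵇ (p ∘ σ) (map σ xs)
      ≡⟨ cong (countᵇ (p ∘ σ) xs +_) (countᵇ-map (p ∘ σ) σ xs) ⟩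
    countᵇ (p ∘ σ) xs + countᵇ (p ∘ σ ∘ σ) xs
      ≡⟨ cong (countᵇ (p ∘ σ) xs +_) (countᵇ-cong (cong p ∘ σ-involutive) xs) ⟩
    countᵇ (p ∘ σ) xs + countᵇ p xs
      ≡⟨ +-comm (countᵇ (p ∘ σ) xs) (countᵇ p xs) ⟩
    countᵇ p xs + countᵇ (p ∘ σ) xs
      ≡⟨ cong (countᵇ p xs +_) (countᵇ-map p σ xs) ⟨
    countᵇ p xs + countᵇ p (map σ xs)
      ≡⟨ countᵇ-++ p xs (map σ xs) ⟨
    countᵇ p (xs ++ map σ xs)
      ∎
    where open ≡-Reasoning

-- n is taken of the form suc k so that shiftV n computes.
module HalfTurn (k : ℕ) where

  n N : ℕ
  n = suc k
  N = 2 * n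

  σ : V n → V n
  σ = shiftV n

  N≡n+n : N ≡ n + n
  N≡n+n = cong (n +_) (+-identityʳ n)

  emb : ℕ → V n
  emb i = just (i mod N)

  toℕ-mod : ∀ i → toℕ (i mod N) ≡ i % N
  toℕ-mod i = toℕ-fromℕ< (m%n<n i N)

  emb-%-cong : ∀ i j → i % N ≡ j % N → emb i ≡ emb j
  emb-%-cong i j eq = cong just (toℕ-injective (trans (toℕ-mod i) (trans eq (sym (toℕ-mod j)))))

  emb-toℕ : (x : Fin N) → emb (toℕ x) ≡ just x
  emb-toℕ x = cong just (toℕ-injective (trans (toℕ-mod (toℕ x)) (m<n⇒m%n≡m (toℕ<n x))))

  σ-emb : ∀ i → σ (emb i) ≡ emb (n + i)
  σ-emb i = emb-%-cong (toℕ (i mod N) + n) (n + i) (begin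
    (toℕ (i mod N) + n) % N   ≡⟨ cong (λ t → (t + n) % N) (toℕ-mod i) ⟩
    (i % N + n) % N           ≡⟨ %-distribˡ-+ (i % N) n N ⟩
    (i % N % N + n % N) % N   ≡⟨ cong (λ t → (t + n % N) % N) (m%n%n≡m%n i N) ⟩
    (i % N + n % N) % N       ≡⟨ %-distribˡ-+ i n N ⟨
    (i + n) % N               ≡⟨ cong (_% N) (+-comm i n) ⟩
    (n + i) % N               ∎)
    where open ≡-Reasoning

  σ-involutive : ∀ v → σ (σ v) ≡ v
  σ-involutive nothing  = refl
  σ-involutive (just x) = begin
    σ (σ (just x))        ≡⟨ cong (σ ∘ σ) (emb-toℕ x) ⟨
    σ (σ (emb i))         ≡⟨ cong σ (σ-emb i) ⟩
    σ (emb (n + i))       ≡⟨ σ-emb (n + i) ⟩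
    emb (n + (n + i))     ≡⟨ emb-%-cong (n + (n + i)) (i + N) (cong (_% N) n+[n+i]≡i+N) ⟩
    emb (i + N)           ≡⟨ emb-%-cong (i + N) i ([m+n]%n≡m%n i N) ⟩
    emb i                 ≡⟨ emb-toℕ x ⟩
    just x                ∎
    where
    open ≡-Reasoning
    i = toℕ x
    n+[n+i]≡i+N : n + (n + i) ≡ i + N
    n+[n+i]≡i+N = trans (sym (+-assoc n n i))
      (trans (+-comm (n + n) i) (cong (i +_) (sym N≡n+n)))

  half : List (V n)
  half = applyUpTo emb n

  vertices-halves : vertices n ≡ ∞ {n} ∷ half ++ map σ half
  vertices-halves = cong (∞ {n} ∷_) (begin
    map just (allFin N)                          ≡⟨ map-tabulate id just ⟩
    tabulate just                                ≡⟨ tabulate-cong (sym ∘ emb-toℕ) ⟩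
    tabulate (emb ∘ toℕ)                         ≡⟨ applyUpTo≡tabulate emb N ⟨
    applyUpTo emb N                              ≡⟨ cong (applyUpTo emb) N≡n+n ⟩
    applyUpTo emb (n + n)                        ≡⟨ applyUpTo-+ emb n n ⟩
    half ++ applyUpTo (emb ∘ (n +_)) n           ≡⟨ cong (half ++_) shifted-half ⟩
    half ++ map σ half                           ∎)
    where
    open ≡-Reasoning
    shifted-half : applyUpTo (emb ∘ (n +_)) n ≡ map σ half
    shifted-half = begin
      applyUpTo (emb ∘ (n +_)) n    ≡⟨ map-upTo (emb ∘ (n +_)) n ⟨
      map (emb ∘ (n +_)) (upTo n)   ≡⟨ map-cong (sym ∘ σ-emb) (upTo n) ⟩
      map (σ ∘ emb) (upTo n)        ≡⟨ map-upTo (σ ∘ emb) n ⟩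
      applyUpTo (σ ∘ emb) n         ≡⟨ map-applyUpTo emb σ n ⟨
      map σ half                    ∎

  countᵇ-∘σ : (p : V n → Bool) → countᵇ (p ∘ σ) (vertices n) ≡ countᵇ p (vertices n)
  countᵇ-∘σ p = subst (λ vs → countᵇ (p ∘ σ) vs ≡ countᵇ p vs) (sym vertices-halves)
    (countᵇ-∷-cong (p ∘ σ) p (∞ {n}) refl (countᵇ-∘-involution-++-map σ p half σ-involutive))

  isOdd-countᵇ-σ-invariant : (p : V n → Bool) → (∀ v → p (σ v) ≡ p v) →
    isOdd (countᵇ p (vertices n)) ≡ p (∞ {n})
  isOdd-countᵇ-σ-invariant p p∘σ≗p = subst (λ vs → isOdd (countᵇ p vs) ≡ p (∞ {n})) (sym vertices-halves)
    (isOdd-countᵇ-∷-double p (∞ {n}) (countᵇ p half) (countᵇ-++-map-invariant σ p half p∘σ≗p))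

  length-vertices : length (vertices n) ≡ suc N
  length-vertices = cong suc (trans (length-map just (allFin N)) (length-tabulate id))

  module Automorphism (adj : V n → V n → Bool) (adj-σ : ∀ u v → adj (σ u) (σ v) ≡ adj u v) where

    ≟V-σ : ∀ v w → _≟V_ {n} (σ v) (σ w) ≡ _≟V_ {n} v w
    ≟V-σ v w with ≡-dec Fin._≟_ (σ v) (σ w) | ≡-dec Fin._≟_ v w
    ... | yes _     | yes _   = refl
    ... | no _      | no _    = refl
    ... | yes σv≡σw | no v≢w  =
      contradiction (trans (sym (σ-involutive v)) (trans (cong σ σv≡σw) (σ-involutive w))) v≢w
    ... | no σv≢σw  | yes v≡w = contradiction (cong σ v≡w) σv≢σw

    reach-σ : ∀ m v w → reach n adj m (σ v) (σ w) ≡ reach n adj m v w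
    reach-σ zero    v w = ≟V-σ v w
    reach-σ (suc m) v w = cong₂ _∨_ (reach-σ m v w) (begin
      any step-σ (vertices n)                    ≡⟨ any≡0<ᵇcountᵇ step-σ (vertices n) ⟩
      0 <ᵇ countᵇ step-σ (vertices n)            ≡⟨ cong (0 <ᵇ_) (countᵇ-∘σ step-σ) ⟨
      0 <ᵇ countᵇ (step-σ ∘ σ) (vertices n)      ≡⟨ cong (0 <ᵇ_) (countᵇ-cong step-σ∘σ≗step (vertices n)) ⟩
      0 <ᵇ countᵇ step (vertices n)              ≡⟨ any≡0<ᵇcountᵇ step (vertices n) ⟨
      any step (vertices n)                      ∎)
      where
      open ≡-Reasoning
      step step-σ : V n → Bool
      step   u = reach n adj m v u ∧ adj u w
      step-σ u = reach n adj m (σ v) u ∧ adj u (σ w)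
      step-σ∘σ≗step : ∀ u → step-σ (σ u) ≡ step u
      step-σ∘σ≗step u = cong₂ _∧_ (reach-σ m v u) (adj-σ u w)

    compSize-σ : ∀ v → compSize {n} adj (σ v) ≡ compSize {n} adj v
    compSize-σ v = trans (sym (countᵇ-∘σ (reach n adj (2 * n + 1) (σ v))))
      (countᵇ-cong (reach-σ (2 * n + 1) v) (vertices n))

    isOdd-vertsOnCyclesOfLength : ∀ ℓ → isOdd (vertsOnCyclesOfLength {n} adj ℓ) ≡ (compSize {n} adj (∞ {n}) ≡ᵇ ℓ)
    isOdd-vertsOnCyclesOfLength ℓ =
      isOdd-countᵇ-σ-invariant (λ v → compSize {n} adj v ≡ᵇ ℓ) (λ v → cong (_≡ᵇ ℓ) (compSize-σ v))

    compSize<2n+2 : compSize {n} adj (∞ {n}) < 2 * n + 2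
    compSize<2n+2 = ≤-trans (s≤s (≤-trans size≤length (≤-reflexive length-vertices)))
      (≤-reflexive (+-comm 2 N))
      where
      size≤length : compSize {n} adj (∞ {n}) ≤ length (vertices n)
      size≤length = countᵇ-≤-length (reach n adj (2 * n + 1) (∞ {n})) (vertices n)

    numOddClasses≡1 : numOddClasses n adj ≡ 1
    numOddClasses≡1 = begin
      countᵇ (isOdd ∘ vertsOnCyclesOfLength {n} adj) (upTo (2 * n + 2))
        ≡⟨ countᵇ-cong isOdd-vertsOnCyclesOfLength (upTo (2 * n + 2)) ⟩
      countᵇ (compSize {n} adj (∞ {n}) ≡ᵇ_) (upTo (2 * n + 2))
        ≡⟨ countᵇ-≡ᵇ-upTo compSize<2n+2 ⟩
      1 ∎
      where open ≡-Reasoning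

proposition3 : (n : ℕ) → 1 ≤ n → (adj : V n → V n → Bool) → TwoRegular n adj
    → (∀ (d : ℕ) → 0 < d → d < 2 Data.Nat.* n
    → Σ (Fin (2 Data.Nat.* n)) λ x → Σ (Fin (2 Data.Nat.* n)) λ y
    → adj (just x) (just y) ≡ true × diff n x y ≡ d)
    → (∀ (u v : V n) → adj (shiftV n u) (shiftV n v) ≡ adj u v)
    → numOddClasses n adj ≡ 1
proposition3 (suc k) _ adj _ _ adj-shift = HalfTurn.Automorphism.numOddClasses≡1 k adj adj-shift
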